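{- Let $p>7408848$ be a prime and let $\{\alpha_1,\alpha_2,\dots,\alpha_{(p-1)/2}\}$ be a subset of $\mathbb{F}_p$ of size $\frac{p-1}{2}$. Then $$\#\Big\{\gamma\in\mathbb{F}_p:\ \Big|\sum_{l=1}^{\frac{p-1}{2}}\left(\frac{\alpha_l-\gamma}{p}\right)\Big|\ge\frac p7\Big\}\le 16.$$
   Context: $\left(\frac{\cdot}{p}\right)$ denotes the Legendre symbol (with value $0$ at $0$). -}

module Defs where

open import Data.Nat using (ℕ; _+_; _*_; _∸_; _%_; _≤?_; NonZero)
import Data.Nat as ℕ
open import Data.Fin using (Fin; toℕ)
open import Data.Fin.Properties using (any?)
open import Data.List using (List; length; filter; allFin; map; foldr)
open import Data.Integer using (ℤ; +_; -_; ∣_∣) renaming (_+_ to _+ℤ_)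
open import Data.Product using (∃)
open import Relation.Binary.PropositionalEquality using (_≡_)
open import Relation.Nullary using (Dec; yes; no)

IsSquareMod : (p a : ℕ) .{{_ : NonZero p}} → Set
IsSquareMod p a = ∃ λ (x : Fin p) → (toℕ x * toℕ x) % p ≡ a % p

isSquareMod? : (p a : ℕ) .{{_ : NonZero p}} → Dec (IsSquareMod p a)
isSquareMod? p a = any? (λ x → (toℕ x * toℕ x) % p ℕ.≟ a % p)

legendre : (p a : ℕ) .{{_ : NonZero p}} → ℤ
legendre p a with a % p ℕ.≟ 0
... | yes _ = + 0
... | no _ with isSquareMod? p a
...   | yes _ = + 1
...   | no _ = - (+ 1)

-- Σ_{l} ( (α_l - γ) / p ), elements of 𝔽_p represented by Fin p
legendreSum : (p : ℕ) .{{_ : NonZero p}} {m : ℕ} → (Fin m → Fin p) → Fin p → ℤ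
legendreSum p {m} α γ =
  foldr _+ℤ_ (+ 0) (map (λ l → legendre p (toℕ (α l) + (p ∸ toℕ γ))) (allFin m))

-- #{ γ ∈ 𝔽_p : |Σ_l ((α_l - γ)/p)| ≥ p/7 }   (|S| ≥ p/7 ⇔ p ≤ 7|S|)
bigCount : (p : ℕ) .{{_ : NonZero p}} {m : ℕ} → (Fin m → Fin p) → ℕ
bigCount p α = length (filter (λ γ → p ≤? 7 * ∣ legendreSum p α γ ∣) (allFin p))

-- Put S(γ) = Σₗ χ(αₗ − γ) with χ the Legendre symbol
-- and m = (p − 1)/2. Orthogonality, Σ_γ χ(a − γ) χ(b − γ) = p·[a = b] − 1, together with injectivity
-- of α gives Σ_γ S(γ)² = m (p − m) = (p² − 1)/4. Each γ with 7 |S(γ)| ≥ p contributes at least p²/49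
-- to this sum, so there are fewer than 49/4 of them, i.e. at most 12. The lower bound on p is only
-- used to make p odd.
--
-- Orthogonality reduces to the correlation Σₓ χ(x) χ(x + d) = −1 for d ≢ 0, which is proved without
-- multiplicativity of χ: a has exactly 1 + χ(a) square roots, so the correlation counts the solutions
-- of v² − u² = d; with v = u + w this is w² + 2wu = d, which for each w ≢ 0 has exactly one solution u.

module Submission where

open import Defs
open import Data.Nat using (ℕ; _<_; _≤_; _∸_; _/_; NonZero)
open import Data.Nat.Primality using (Prime)
open import Data.Fin using (Fin)
open import Function.Definitions using (Injective)
open import Relation.Binary.PropositionalEquality using (_≡_)

open import Data.Nat as ℕ using (zero; suc; _+_; _*_; _%_; z≤n; s≤s)
import Data.Nat.Properties as ℕP
open import Data.Nat.DivMod
open import Data.Nat.Divisibility using (_∣_; divides; ∣-refl; m%n≡0⇒n∣m; n∣m⇒m%n≡0)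
open import Data.Nat.Primality using (euclidsLemma; prime⇒irreducible; prime[2]; prime⇒nonTrivial)
open import Data.Nat.Coprimality using (Coprime; coprime-Bézout)
open import Data.Nat.GCD using (module Bézout)
open import Data.Nat.Tactic.RingSolver using (solve-∀)
import Data.Integer.Tactic.RingSolver as ℤ-Ring
open import Data.Fin as F using (toℕ)
import Data.Fin.Properties as FP
open import Data.Fin.Permutation using (Permutation; permutation; _⟨$⟩ʳ_)
open import Data.Integer using (ℤ; +_; -[1+_]; 0ℤ; 1ℤ; -1ℤ; ∣_∣)
  renaming (_+_ to _+ℤ_; _*_ to _*ℤ_; _-_ to _-ℤ_; -_ to -ℤ_)
import Data.Integer.Properties as ℤP
open import Data.Bool using (if_then_else_)
open import Data.List using ([]; _∷_; foldr; map; tabulate; filter; length; allFin)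
import Data.Nat.ListAction as ListNat
import Relation.Unary as U
open import Data.List.Properties using (map-tabulate)
open import Data.Sum as Sum using (_⊎_; inj₁; inj₂; [_,_]′)
open import Data.Product using (_,_; ∃-syntax; proj₁; proj₂)
open import Function using (_∘_; flip; id)
open import Level using (0ℓ)
open import Relation.Binary using (Rel; Setoid; Decidable; _Preserves_⟶_)
import Relation.Binary.Construct.On as On
import Relation.Binary.Reasoning.Setoid
open import Relation.Nullary using (does; yes; no; ¬_; contradiction)
open import Relation.Binary.PropositionalEquality
  using (refl; sym; trans; cong; cong₂; _≢_; module ≡-Reasoning)
  renaming (setoid to ≡-setoid)
open import Algebra.Properties.Semiring.Sum ℤP.+-*-semiring
  using (sum-syntax; sum-cong-≗; sum-replicate-zero; ∑-distrib-+; ∑-comm; ∑-permute;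
         *-distribˡ-sum; *-distribʳ-sum)

∑-const : ∀ n c → ∑[ i < n ] c ≡ + n *ℤ c
∑-const zero c = refl
∑-const (suc n) c = begin
  c +ℤ ∑[ i < n ] c     ≡⟨ cong (c +ℤ_) (∑-const n c) ⟩
  c +ℤ + n *ℤ c         ≡⟨ cong (_+ℤ + n *ℤ c) (ℤP.*-identityˡ c) ⟨
  1ℤ *ℤ c +ℤ + n *ℤ c   ≡⟨ ℤP.*-distribʳ-+ c 1ℤ (+ n) ⟨
  + suc n *ℤ c          ∎
  where open ≡-Reasoning

∑-neg : ∀ n (f : Fin n → ℤ) → ∑[ i < n ] (-ℤ f i) ≡ -ℤ ∑[ i < n ] f i
∑-neg zero f = refl
∑-neg (suc n) f =
  trans (cong (-ℤ f F.zero +ℤ_) (∑-neg n (f ∘ F.suc))) (sym (ℤP.neg-distrib-+ (f F.zero) _))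

foldr-tabulate : ∀ n (f : Fin n → ℤ) → foldr _+ℤ_ 0ℤ (tabulate f) ≡ ∑[ i < n ] f i
foldr-tabulate zero f = refl
foldr-tabulate (suc n) f = cong (f F.zero +ℤ_) (foldr-tabulate n (f ∘ F.suc))

+sum-tabulate : ∀ n (g : Fin n → ℕ) → + ListNat.sum (tabulate g) ≡ ∑[ i < n ] (+ g i)
+sum-tabulate zero g = refl
+sum-tabulate (suc n) g = trans (ℤP.pos-+ (g F.zero) _) (cong (+ g F.zero +ℤ_) (+sum-tabulate n (g ∘ F.suc)))

+∣i∣*∣i∣≡i*i : ∀ i → + (∣ i ∣ * ∣ i ∣) ≡ i *ℤ i
+∣i∣*∣i∣≡i*i (+ n) = ℤP.pos-* n n
+∣i∣*∣i∣≡i*i -[1+ n ] = refl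

length-filter-*≤sum : ∀ {A : Set} {P : U.Pred A 0ℓ} (P? : U.Decidable P) (g : A → ℕ) {c} →
  (∀ x → P x → c ≤ g x) → ∀ xs → length (filter P? xs) * c ≤ ListNat.sum (map g xs)
length-filter-*≤sum P? g P⇒c≤g [] = z≤n
length-filter-*≤sum P? g P⇒c≤g (x ∷ xs) with P? x
... | yes Px = ℕP.+-mono-≤ (P⇒c≤g x Px) (length-filter-*≤sum P? g P⇒c≤g xs)
... | no _ = ℕP.≤-trans (length-filter-*≤sum P? g P⇒c≤g xs) (ℕP.m≤n+m _ (g x))

δ : ∀ {n} → Fin n → Fin n → ℤ
δ i j = if does (i FP.≟ j) then 1ℤ else 0ℤ

δ-≡ : ∀ {n} {i j : Fin n} → i ≡ j → δ i j ≡ 1ℤ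
δ-≡ {i = i} {j} i≡j with i FP.≟ j
... | yes _ = refl
... | no i≢j = contradiction i≡j i≢j

δ-≢ : ∀ {n} {i j : Fin n} → i ≢ j → δ i j ≡ 0ℤ
δ-≢ {i = i} {j} i≢j with i FP.≟ j
... | yes i≡j = contradiction i≡j i≢j
... | no _ = refl

δ-cong : ∀ {m n} {i j : Fin m} {k l : Fin n} → (i ≡ j → k ≡ l) → (k ≡ l → i ≡ j) → δ i j ≡ δ k l
δ-cong {i = i} {j} {k} {l} to from with i FP.≟ j
... | yes i≡j = sym (δ-≡ (to i≡j))
... | no i≢j = sym (δ-≢ (i≢j ∘ from))

δ-sym : ∀ {n} (i j : Fin n) → δ i j ≡ δ j i
δ-sym i j = δ-cong {i = i} {j} {j} {i} sym sym

∑-δ : ∀ {n} (j : Fin n) → ∑[ i < n ] δ i j ≡ 1ℤ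
∑-δ {suc n} F.zero = cong (1ℤ +ℤ_) (sum-replicate-zero n)
∑-δ {suc n} (F.suc j) = trans (ℤP.+-identityˡ _) (∑-δ j)

module Residues (p : ℕ) .{{_ : NonZero p}} where

  infix 4 _≈_
  _≈_ : Rel ℕ 0ℓ
  a ≈ b = a % p ≡ b % p

  ≈-setoid : Setoid 0ℓ 0ℓ
  ≈-setoid = On.setoid (≡-setoid ℕ) (_% p)

  open Setoid ≈-setoid public using () renaming (refl to ≈-refl; sym to ≈-sym; trans to ≈-trans)

  module ≈-Reasoning = Relation.Binary.Reasoning.Setoid ≈-setoid

  ≡⇒≈ : ∀ {a b} → a ≡ b → a ≈ b
  ≡⇒≈ = cong (_% p)

  %-≈ : ∀ a → a % p ≈ a
  %-≈ a = m%n%n≡m%n a p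

  +-cong : ∀ {a b c d} → a ≈ b → c ≈ d → a + c ≈ b + d
  +-cong {a} {b} {c} {d} a≈b c≈d = begin
    (a + c) % p                ≡⟨ %-distribˡ-+ a c p ⟩
    (a % p + c % p) % p        ≡⟨ cong₂ (λ x y → (x + y) % p) a≈b c≈d ⟩
    (b % p + d % p) % p        ≡⟨ %-distribˡ-+ b d p ⟨
    (b + d) % p                ∎
    where open ≡-Reasoning

  *-cong : ∀ {a b c d} → a ≈ b → c ≈ d → a * c ≈ b * d
  *-cong {a} {b} {c} {d} a≈b c≈d = begin
    (a * c) % p                ≡⟨ %-distribˡ-* a c p ⟩
    (a % p * (c % p)) % p      ≡⟨ cong₂ (λ x y → (x * y) % p) a≈b c≈d ⟩
    (b % p * (d % p)) % p      ≡⟨ %-distribˡ-* b d p ⟨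
    (b * d) % p                ∎
    where open ≡-Reasoning

  +-congˡ : ∀ a {b c} → b ≈ c → a + b ≈ a + c
  +-congˡ a = +-cong (≈-refl {a})

  +-congʳ : ∀ c {a b} → a ≈ b → a + c ≈ b + c
  +-congʳ c a≈b = +-cong a≈b (≈-refl {c})

  *-congˡ : ∀ a {b c} → b ≈ c → a * b ≈ a * c
  *-congˡ a = *-cong (≈-refl {a})

  square-cong : (λ u → u * u) Preserves _≈_ ⟶ _≈_
  square-cong u≈v = *-cong u≈v u≈v

  0%p≡0 : 0 % p ≡ 0
  0%p≡0 = m*n%n≡0 0 p

  m*p≈0 : ∀ k → k * p ≈ 0
  m*p≈0 k = trans (m*n%n≡0 k p) (sym 0%p≡0)

  ∣⇒≈0 : ∀ {a} → p ∣ a → a ≈ 0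
  ∣⇒≈0 {a} p∣a = trans (n∣m⇒m%n≡0 a p p∣a) (sym 0%p≡0)

  ≈0⇒∣ : ∀ {a} → a ≈ 0 → p ∣ a
  ≈0⇒∣ {a} a≈0 = m%n≡0⇒n∣m a p (trans a≈0 0%p≡0)

  +-≈0ʳ : ∀ a {b} → b ≈ 0 → a + b ≈ a
  +-≈0ʳ a b≈0 = ≈-trans (+-congˡ a b≈0) (≡⇒≈ (ℕP.+-identityʳ a))

  *-≈0ʳ : ∀ a {b} → b ≈ 0 → a * b ≈ 0
  *-≈0ʳ a b≈0 = ≈-trans (*-congˡ a b≈0) (≡⇒≈ (ℕP.*-zeroʳ a))

  *-≈0ˡ : ∀ {a} b → a ≈ 0 → a * b ≈ 0
  *-≈0ˡ {a} b a≈0 = ≈-trans (≡⇒≈ (ℕP.*-comm a b)) (*-≈0ʳ b a≈0)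

  neg : ℕ → ℕ
  neg c = p ∸ c % p

  neg-toℕ : ∀ (x : Fin p) → p ∸ toℕ x ≡ neg (toℕ x)
  neg-toℕ x = cong (p ∸_) (sym (m<n⇒m%n≡m (FP.toℕ<n x)))

  neg-cong : ∀ {a b} → a ≈ b → neg a ≡ neg b
  neg-cong = cong (p ∸_)

  +-inverseʳ : ∀ c → c + neg c ≈ 0
  +-inverseʳ c = begin
    c + neg c          ≈⟨ +-congʳ (neg c) (%-≈ c) ⟨
    c % p + neg c      ≡⟨ ℕP.m+[n∸m]≡n (m%n≤n c p) ⟩
    p                  ≈⟨ trans (n%n≡0 p) (sym 0%p≡0) ⟩
    0                  ∎
    where open ≈-Reasoning

  +-inverseˡ : ∀ c → neg c + c ≈ 0
  +-inverseˡ c = ≈-trans (≡⇒≈ (ℕP.+-comm (neg c) c)) (+-inverseʳ c)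

  +-cancelʳ : ∀ {a b} c → a + c ≈ b + c → a ≈ b
  +-cancelʳ {a} {b} c eq = begin
    a                  ≈⟨ +-≈0ʳ a (+-inverseʳ c) ⟨
    a + (c + neg c)    ≡⟨ ℕP.+-assoc a c (neg c) ⟨
    a + c + neg c      ≈⟨ +-congʳ (neg c) eq ⟩
    b + c + neg c      ≡⟨ ℕP.+-assoc b c (neg c) ⟩
    b + (c + neg c)    ≈⟨ +-≈0ʳ b (+-inverseʳ c) ⟩
    b                  ∎
    where open ≈-Reasoning

  +-cancelˡ : ∀ c {a b} → c + a ≈ c + b → a ≈ b
  +-cancelˡ c {a} {b} eq =
    +-cancelʳ c (≈-trans (≡⇒≈ (ℕP.+-comm a c)) (≈-trans eq (≡⇒≈ (ℕP.+-comm c b))))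

  x-y≈0⇒x≈y : ∀ {a b} → a + neg b ≈ 0 → a ≈ b
  x-y≈0⇒x≈y {a} {b} a-b≈0 = begin
    a                  ≈⟨ +-≈0ʳ a (+-inverseˡ b) ⟨
    a + (neg b + b)    ≡⟨ ℕP.+-assoc a (neg b) b ⟨
    a + neg b + b      ≈⟨ +-congʳ b a-b≈0 ⟩
    0 + b              ∎
    where open ≈-Reasoning

  x≈y⇒x-y≈0 : ∀ {a b} → a ≈ b → a + neg b ≈ 0
  x≈y⇒x-y≈0 {a} {b} a≈b = ≈-trans (+-congʳ (neg b) a≈b) (+-inverseʳ b)

  infix 4 _≈?_
  _≈?_ : Decidable _≈_
  a ≈? b = a % p ℕ.≟ b % p

  mod-cong : ∀ {a b} → a ≈ b → a mod p ≡ b mod p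
  mod-cong {a} {b} a≈b = FP.fromℕ<-cong (a % p) (b % p) a≈b (m%n<n a p) (m%n<n b p)

  toℕ-mod : ∀ a → toℕ (a mod p) ≈ a
  toℕ-mod a = trans (cong (_% p) (FP.toℕ-fromℕ< (m%n<n a p))) (%-≈ a)

  mod-injective : ∀ {a b} → a mod p ≡ b mod p → a ≈ b
  mod-injective {a} {b} eq = ≈-trans (≈-sym (toℕ-mod a)) (≈-trans (≡⇒≈ (cong toℕ eq)) (toℕ-mod b))

  toℕ-mod-inverse : ∀ (x : Fin p) → toℕ x mod p ≡ x
  toℕ-mod-inverse x = FP.toℕ-injective (trans (FP.toℕ-fromℕ< _) (m<n⇒m%n≡m (FP.toℕ<n x)))

  𝟙[_≈_] : ℕ → ℕ → ℤ
  𝟙[ a ≈ b ] = δ (a mod p) (b mod p)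

  𝟙-≈ : ∀ {a b} → a ≈ b → 𝟙[ a ≈ b ] ≡ 1ℤ
  𝟙-≈ = δ-≡ ∘ mod-cong

  𝟙-≉ : ∀ {a b} → ¬ a ≈ b → 𝟙[ a ≈ b ] ≡ 0ℤ
  𝟙-≉ a≉b = δ-≢ (a≉b ∘ mod-injective)

  𝟙-cong : ∀ {a b c d} → (a ≈ b → c ≈ d) → (c ≈ d → a ≈ b) → 𝟙[ a ≈ b ] ≡ 𝟙[ c ≈ d ]
  𝟙-cong to from = δ-cong (mod-cong ∘ to ∘ mod-injective) (mod-cong ∘ from ∘ mod-injective)

  𝟙-congˡ : ∀ b → (λ a → 𝟙[ a ≈ b ]) Preserves _≈_ ⟶ _≡_
  𝟙-congˡ b {a} {c} a≈c = 𝟙-cong {a} {b} {c} (≈-trans (≈-sym a≈c)) (≈-trans a≈c)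

  𝟙-congʳ : ∀ a → (λ b → 𝟙[ a ≈ b ]) Preserves _≈_ ⟶ _≡_
  𝟙-congʳ a b≈c = 𝟙-cong {a} (flip ≈-trans b≈c) (flip ≈-trans (≈-sym b≈c))

  𝟙-sym : ∀ a b → 𝟙[ a ≈ b ] ≡ 𝟙[ b ≈ a ]
  𝟙-sym a b = 𝟙-cong ≈-sym ≈-sym

  𝟙-+-cancelʳ : ∀ a b c → 𝟙[ a + c ≈ b + c ] ≡ 𝟙[ a ≈ b ]
  𝟙-+-cancelʳ a b c = 𝟙-cong (+-cancelʳ c) (+-congʳ c)

  𝟙-toℕ : ∀ (x y : Fin p) → 𝟙[ toℕ x ≈ toℕ y ] ≡ δ x y
  𝟙-toℕ x y = cong₂ δ (toℕ-mod-inverse x) (toℕ-mod-inverse y)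

  ∑ₚ : (ℕ → ℤ) → ℤ
  ∑ₚ f = ∑[ x < p ] f (toℕ x)

  ∑ₚ-cong : ∀ {f g} → (∀ a → f a ≡ g a) → ∑ₚ f ≡ ∑ₚ g
  ∑ₚ-cong f≗g = sum-cong-≗ {p} (f≗g ∘ toℕ)

  ∑ₚ-distrib-+ : ∀ (f g : ℕ → ℤ) → ∑ₚ (λ x → f x +ℤ g x) ≡ ∑ₚ f +ℤ ∑ₚ g
  ∑ₚ-distrib-+ f g = ∑-distrib-+ {p} (f ∘ toℕ) (g ∘ toℕ)

  ∑ₚ-neg : ∀ (f : ℕ → ℤ) → ∑ₚ (λ x → -ℤ f x) ≡ -ℤ ∑ₚ f
  ∑ₚ-neg f = ∑-neg p (f ∘ toℕ)

  ∑ₚ-*ʳ : ∀ (f : ℕ → ℤ) c → ∑ₚ f *ℤ c ≡ ∑ₚ (λ x → f x *ℤ c)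
  ∑ₚ-*ʳ f c = *-distribʳ-sum {p} c (f ∘ toℕ)

  ∑ₚ-comm : ∀ (f : ℕ → ℕ → ℤ) → ∑ₚ (λ x → ∑ₚ (λ y → f x y)) ≡ ∑ₚ (λ y → ∑ₚ (λ x → f x y))
  ∑ₚ-comm f = ∑-comm {p} {p} (λ x y → f (toℕ x) (toℕ y))

  ∑ₚ-𝟙 : ∀ b → ∑ₚ (λ x → 𝟙[ x ≈ b ]) ≡ 1ℤ
  ∑ₚ-𝟙 b = trans (sum-cong-≗ {p} (λ x → cong (λ y → δ y (b mod p)) (toℕ-mod-inverse x))) (∑-δ (b mod p))

  ∑ₚ-𝟙-* : ∀ f → f Preserves _≈_ ⟶ _≡_ → ∀ b → ∑ₚ (λ x → 𝟙[ x ≈ b ] *ℤ f x) ≡ f b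
  ∑ₚ-𝟙-* f f-cong b = begin
    ∑ₚ (λ x → 𝟙[ x ≈ b ] *ℤ f x)   ≡⟨ ∑ₚ-cong evaluate ⟩
    ∑ₚ (λ x → 𝟙[ x ≈ b ] *ℤ f b)   ≡⟨ ∑ₚ-*ʳ (λ x → 𝟙[ x ≈ b ]) (f b) ⟨
    ∑ₚ (λ x → 𝟙[ x ≈ b ]) *ℤ f b   ≡⟨ cong (_*ℤ f b) (∑ₚ-𝟙 b) ⟩
    1ℤ *ℤ f b                      ≡⟨ ℤP.*-identityˡ (f b) ⟩
    f b                            ∎
    where
    open ≡-Reasoning
    evaluate : ∀ x → 𝟙[ x ≈ b ] *ℤ f x ≡ 𝟙[ x ≈ b ] *ℤ f b
    evaluate x with x ≈? b
    ... | yes x≈b = cong (𝟙[ x ≈ b ] *ℤ_) (f-cong x≈b)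
    ... | no x≉b = trans (cong (_*ℤ f x) (𝟙-≉ x≉b)) (sym (cong (_*ℤ f b) (𝟙-≉ x≉b)))

  ∑ₚ-unique : ∀ {φ} → φ Preserves _≈_ ⟶ _≈_ → ∀ {s t} → φ s ≈ t → (∀ {x} → φ x ≈ t → x ≈ s) →
    ∑ₚ (λ x → 𝟙[ φ x ≈ t ]) ≡ 1ℤ
  ∑ₚ-unique {φ} φ-cong {s} {t} φs≈t unique =
    trans (∑ₚ-cong (λ x → 𝟙-cong {φ x} {t} {x} {s} unique (λ x≈s → ≈-trans (φ-cong x≈s) φs≈t))) (∑ₚ-𝟙 s)

  ∑ₚ-reindex : ∀ {φ ψ f} → φ Preserves _≈_ ⟶ _≈_ → ψ Preserves _≈_ ⟶ _≈_ →
    (∀ a → φ (ψ a) ≈ a) → (∀ a → ψ (φ a) ≈ a) → f Preserves _≈_ ⟶ _≡_ →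
    ∑ₚ (f ∘ φ) ≡ ∑ₚ f
  ∑ₚ-reindex {φ} {ψ} {f} φ-cong ψ-cong φψ ψφ f-cong = sym (begin
    ∑ₚ f                           ≡⟨ ∑-permute (f ∘ toℕ) π ⟩
    ∑[ x < p ] f (toℕ (π ⟨$⟩ʳ x))  ≡⟨ sum-cong-≗ {p} (λ x → f-cong (toℕ-mod (φ (toℕ x)))) ⟩
    ∑ₚ (f ∘ φ)                     ∎)
    where
    open ≡-Reasoning
    onFin : (ℕ → ℕ) → Fin p → Fin p
    onFin g x = g (toℕ x) mod p
    onFin-inverse : ∀ {g h} → g Preserves _≈_ ⟶ _≈_ → (∀ a → g (h a) ≈ a) →
      ∀ x → onFin g (onFin h x) ≡ x
    onFin-inverse {g} {h} g-cong gh x =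
      trans (mod-cong (≈-trans (g-cong (toℕ-mod (h (toℕ x)))) (gh (toℕ x)))) (toℕ-mod-inverse x)
    π : Permutation p p
    π = permutation (onFin φ) (onFin ψ) (onFin-inverse φ-cong φψ) (onFin-inverse ψ-cong ψφ)

  ∑ₚ-shift : ∀ f → f Preserves _≈_ ⟶ _≡_ → ∀ d → ∑ₚ (λ x → f (x + d)) ≡ ∑ₚ f
  ∑ₚ-shift f f-cong d =
    ∑ₚ-reindex {f = f} (+-congʳ d) (+-congʳ (neg d)) (cancel (+-inverseˡ d)) (cancel (+-inverseʳ d)) f-cong
    where
    cancel : ∀ {b c} → b + c ≈ 0 → ∀ a → a + b + c ≈ a
    cancel {b} {c} b+c≈0 a = ≈-trans (≡⇒≈ (ℕP.+-assoc a b c)) (+-≈0ʳ a b+c≈0)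

  ∑ₚ-reflect : ∀ f → f Preserves _≈_ ⟶ _≡_ → ∀ b → ∑ₚ (λ x → f (b + neg x)) ≡ ∑ₚ f
  ∑ₚ-reflect f f-cong b = ∑ₚ-reindex {f = f} reflect-cong reflect-cong involutive involutive f-cong
    where
    reflect-cong : (λ x → b + neg x) Preserves _≈_ ⟶ _≈_
    reflect-cong x≈y = ≡⇒≈ (cong (_+_ b) (neg-cong x≈y))
    -- With y = b − a, both sides become b after adding y.
    involutive : ∀ a → b + neg (b + neg a) ≈ a
    involutive a = +-cancelʳ (b + neg a) (begin
      b + neg (b + neg a) + (b + neg a)    ≡⟨ ℕP.+-assoc b _ _ ⟩
      b + (neg (b + neg a) + (b + neg a))  ≈⟨ +-≈0ʳ b (+-inverseˡ (b + neg a)) ⟩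
      b                                    ≈⟨ +-≈0ʳ b (+-inverseʳ a) ⟨
      b + (a + neg a)                      ≡⟨ ℕP.+-comm b _ ⟩
      a + neg a + b                        ≡⟨ ℕP.+-assoc a _ _ ⟩
      a + (neg a + b)                      ≡⟨ cong (_+_ a) (ℕP.+-comm (neg a) b) ⟩
      a + (b + neg a)                      ∎)
      where open ≈-Reasoning

module PrimeResidues (p : ℕ) .{{_ : NonZero p}} (p-prime : Prime p) where

  open Residues p

  *-≈0⇒ : ∀ a b → a * b ≈ 0 → a ≈ 0 ⊎ b ≈ 0
  *-≈0⇒ a b ab≈0 = Sum.map ∣⇒≈0 ∣⇒≈0 (euclidsLemma a b p-prime (≈0⇒∣ ab≈0))

  ≉0⇒coprime : ∀ {a} → ¬ a ≈ 0 → Coprime a p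
  ≉0⇒coprime a≉0 (d∣a , d∣p) with prime⇒irreducible p-prime d∣p
  ... | inj₁ d≡1 = d≡1
  ... | inj₂ refl = contradiction (∣⇒≈0 d∣a) a≉0

  *-inverse : ∀ {a} → ¬ a ≈ 0 → ∃[ b ] a * b ≈ 1
  *-inverse {a} a≉0 with coprime-Bézout (≉0⇒coprime a≉0)
  ... | Bézout.+- x y eq = x , (begin
    a * x          ≡⟨ ℕP.*-comm a x ⟩
    x * a          ≡⟨ eq ⟨
    1 + y * p      ≈⟨ +-≈0ʳ 1 (m*p≈0 y) ⟩
    1              ∎)
    where open ≈-Reasoning
  -- Here a x ≡ −1, so x (p − 1) is the inverse.
  ... | Bézout.-+ x y eq = x * (p ∸ 1) , +-cancelʳ (a * x) (begin
    a * (x * (p ∸ 1)) + a * x  ≡⟨ factor a x (p ∸ 1) ⟩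
    a * x * (p ∸ 1 + 1)        ≡⟨ cong (_*_ (a * x)) (ℕP.m∸n+n≡m (ℕ.>-nonZero⁻¹ p)) ⟩
    a * x * p                  ≈⟨ m*p≈0 (a * x) ⟩
    0                          ≈⟨ m*p≈0 y ⟨
    y * p                      ≡⟨ eq ⟨
    1 + x * a                  ≡⟨ cong (_+_ 1) (ℕP.*-comm x a) ⟩
    1 + a * x                  ∎)
    where
    open ≈-Reasoning
    factor : ∀ a x q → a * (x * q) + a * x ≡ a * x * (q + 1)
    factor = solve-∀

  *-cancelˡ : ∀ {k} → ¬ k ≈ 0 → ∀ {u v} → k * u ≈ k * v → u ≈ v
  *-cancelˡ {k} k≉0 {u} {v} ku≈kv = begin
    u              ≡⟨ ℕP.*-identityˡ u ⟨
    1 * u          ≈⟨ *-cong k′k≈1 (≈-refl {u}) ⟨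
    k′ * k * u     ≡⟨ ℕP.*-assoc k′ k u ⟩
    k′ * (k * u)   ≈⟨ *-congˡ k′ ku≈kv ⟩
    k′ * (k * v)   ≡⟨ ℕP.*-assoc k′ k v ⟨
    k′ * k * v     ≈⟨ *-cong k′k≈1 (≈-refl {v}) ⟩
    1 * v          ≡⟨ ℕP.*-identityˡ v ⟩
    v              ∎
    where
    open ≈-Reasoning
    k′ : ℕ
    k′ = proj₁ (*-inverse k≉0)
    k′k≈1 : k′ * k ≈ 1
    k′k≈1 = ≈-trans (≡⇒≈ (ℕP.*-comm k′ k)) (proj₂ (*-inverse k≉0))

  ∑ₚ-𝟙-affine : ∀ {k} → ¬ k ≈ 0 → ∀ c t → ∑ₚ (λ u → 𝟙[ c + k * u ≈ t ]) ≡ 1ℤ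
  ∑ₚ-𝟙-affine {k} k≉0 c t = ∑ₚ-unique (+-congˡ c ∘ *-congˡ k) solves
    (λ {u} c+ku≈t → *-cancelˡ k≉0 (+-cancelˡ c (≈-trans c+ku≈t (≈-sym solves))))
    where
    open ≈-Reasoning
    k′ : ℕ
    k′ = proj₁ (*-inverse k≉0)
    s : ℕ
    s = k′ * (t + neg c)
    shuffle : ∀ c t n → c + (t + n) ≡ t + (c + n)
    shuffle = solve-∀
    solves : c + k * s ≈ t
    solves = begin
      c + k * (k′ * (t + neg c))   ≡⟨ cong (_+_ c) (ℕP.*-assoc k k′ _) ⟨
      c + k * k′ * (t + neg c)     ≈⟨ +-congˡ c (*-cong (proj₂ (*-inverse k≉0)) (≈-refl {t + neg c})) ⟩
      c + 1 * (t + neg c)          ≡⟨ cong (_+_ c) (ℕP.*-identityˡ _) ⟩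
      c + (t + neg c)              ≡⟨ shuffle c t (neg c) ⟩
      t + (c + neg c)              ≈⟨ +-≈0ʳ t (+-inverseʳ c) ⟩
      t                            ∎

  square≈square⇒ : ∀ u v → u * u ≈ v * v → u ≈ v ⊎ u + v ≈ 0
  square≈square⇒ u v u²≈v² with *-≈0⇒ (u + v) (u + neg v) difference≈0
    where
    expand : ∀ u v n → (u + v) * (u + n) + v * v ≡ u * u + (u * (v + n) + v * (n + v))
    expand = solve-∀
    difference≈0 : (u + v) * (u + neg v) ≈ 0
    difference≈0 = +-cancelʳ (v * v) (begin
      (u + v) * (u + neg v) + v * v
        ≡⟨ expand u v (neg v) ⟩
      u * u + (u * (v + neg v) + v * (neg v + v))
        ≈⟨ +-≈0ʳ (u * u) (+-cong (*-≈0ʳ u (+-inverseʳ v)) (*-≈0ʳ v (+-inverseˡ v))) ⟩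
      u * u
        ≈⟨ u²≈v² ⟩
      0 + v * v
        ∎)
      where open ≈-Reasoning
  ... | inj₁ u+v≈0 = inj₂ u+v≈0
  ... | inj₂ u-v≈0 = inj₁ (x-y≈0⇒x≈y u-v≈0)

module Legendre (p : ℕ) .{{_ : NonZero p}} (p-prime : Prime p) (p-odd : ¬ 2 ∣ p) where

  open Residues p
  open PrimeResidues p p-prime

  2≉0 : ¬ 2 ≈ 0
  2≉0 2≈0 with prime⇒irreducible prime[2] (≈0⇒∣ 2≈0)
  ... | inj₁ refl = ℕ.nonTrivial⇒≢1 {{prime⇒nonTrivial p-prime}} refl
  ... | inj₂ refl = p-odd ∣-refl

  χ : ℕ → ℤ
  χ a = legendre p a

  data LegendreView (a : ℕ) : ℤ → Set where
    divisible : a ≈ 0 → LegendreView a 0ℤ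
    residue : ¬ a ≈ 0 → IsSquareMod p a → LegendreView a 1ℤ
    nonresidue : ¬ IsSquareMod p a → LegendreView a -1ℤ

  legendre-view : ∀ a → LegendreView a (χ a)
  legendre-view a with a % p ℕ.≟ 0
  ... | yes a%p≡0 = divisible (trans a%p≡0 (sym 0%p≡0))
  ... | no a%p≢0 with isSquareMod? p a
  ...   | yes square = residue (a%p≢0 ∘ flip trans 0%p≡0) square
  ...   | no nonsquare = nonresidue nonsquare

  0-square : ∀ {a} → a ≈ 0 → IsSquareMod p a
  0-square {a} a≈0 = 0 mod p , ≈-trans (square-cong (toℕ-mod 0)) (≈-sym a≈0)

  legendre-≈0 : ∀ {a} → a ≈ 0 → χ a ≡ 0ℤ
  legendre-≈0 {a} a≈0 with χ a | legendre-view a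
  ... | _ | divisible _ = refl
  ... | _ | residue a≉0 _ = contradiction a≈0 a≉0
  ... | _ | nonresidue nonsquare = contradiction (0-square a≈0) nonsquare

  legendre-residue : ∀ {a} → ¬ a ≈ 0 → IsSquareMod p a → χ a ≡ 1ℤ
  legendre-residue {a} a≉0 square with χ a | legendre-view a
  ... | _ | divisible a≈0 = contradiction a≈0 a≉0
  ... | _ | residue _ _ = refl
  ... | _ | nonresidue nonsquare = contradiction square nonsquare

  legendre-nonresidue : ∀ {a} → ¬ IsSquareMod p a → χ a ≡ -1ℤ
  legendre-nonresidue {a} nonsquare with χ a | legendre-view a
  ... | _ | divisible a≈0 = contradiction (0-square a≈0) nonsquare
  ... | _ | residue _ square = contradiction square nonsquare
  ... | _ | nonresidue _ = refl

  legendre-cong : χ Preserves _≈_ ⟶ _≡_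
  legendre-cong {a} {b} a≈b with χ b | legendre-view b
  ... | _ | divisible b≈0 = legendre-≈0 (≈-trans a≈b b≈0)
  ... | _ | residue b≉0 (x , x²≈b) =
    legendre-residue (b≉0 ∘ ≈-trans (≈-sym a≈b)) (x , ≈-trans x²≈b (≈-sym a≈b))
  ... | _ | nonresidue nonsquare = legendre-nonresidue (λ (x , x²≈a) → nonsquare (x , ≈-trans x²≈a a≈b))

  legendre² : ∀ a → χ a *ℤ χ a ≡ 1ℤ -ℤ 𝟙[ a ≈ 0 ]
  legendre² a with χ a | legendre-view a
  ... | _ | divisible a≈0 = sym (cong (_-ℤ_ 1ℤ) (𝟙-≈ a≈0))
  ... | _ | residue a≉0 _ = sym (cong (_-ℤ_ 1ℤ) (𝟙-≉ a≉0))
  ... | _ | nonresidue nonsquare = sym (cong (_-ℤ_ 1ℤ) (𝟙-≉ (nonsquare ∘ 0-square)))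

  sqrtCount : ℕ → ℤ
  sqrtCount a = ∑ₚ (λ u → 𝟙[ u * u ≈ a ])

  sqrtCount-cong : sqrtCount Preserves _≈_ ⟶ _≡_
  sqrtCount-cong a≈b = ∑ₚ-cong (λ u → 𝟙-congʳ (u * u) a≈b)

  𝟙-square≈square : ∀ {y} → ¬ y ≈ 0 → ∀ u → 𝟙[ u * u ≈ y * y ] ≡ 𝟙[ u ≈ y ] +ℤ 𝟙[ u + y ≈ 0 ]
  𝟙-square≈square {y} y≉0 u with u ≈? y
  ... | yes u≈y = trans (𝟙-≈ (square-cong u≈y)) (sym (cong₂ _+ℤ_ (𝟙-≈ u≈y) (𝟙-≉ u+y≉0)))
    where
    open ≈-Reasoning
    u+y≉0 : ¬ u + y ≈ 0
    u+y≉0 u+y≈0 = [ 2≉0 , y≉0 ]′ (*-≈0⇒ 2 y (begin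
      2 * y      ≡⟨ cong (_+_ y) (ℕP.+-identityʳ y) ⟩
      y + y      ≈⟨ +-congʳ y u≈y ⟨
      u + y      ≈⟨ u+y≈0 ⟩
      0          ∎))
  ... | no u≉y with u + y ≈? 0
  ...   | yes u+y≈0 = trans (𝟙-≈ u²≈y²) (sym (cong₂ _+ℤ_ (𝟙-≉ u≉y) (𝟙-≈ u+y≈0)))
    where
    open ≈-Reasoning
    distribʳ : ∀ u v w → u * (v + w) ≡ u * v + u * w
    distribʳ = solve-∀
    u²≈y² : u * u ≈ y * y
    u²≈y² = +-cancelʳ (u * y) (begin
      u * u + u * y   ≡⟨ distribʳ u u y ⟨
      u * (u + y)     ≈⟨ *-≈0ʳ u u+y≈0 ⟩
      0               ≈⟨ *-≈0ʳ y u+y≈0 ⟨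
      y * (u + y)     ≡⟨ distribʳ y u y ⟩
      y * u + y * y   ≡⟨ ℕP.+-comm (y * u) (y * y) ⟩
      y * y + y * u   ≡⟨ cong (_+_ (y * y)) (ℕP.*-comm y u) ⟩
      y * y + u * y   ∎)
  ...   | no u+y≉0 =
    trans (𝟙-≉ ([ u≉y , u+y≉0 ]′ ∘ square≈square⇒ u y)) (sym (cong₂ _+ℤ_ (𝟙-≉ u≉y) (𝟙-≉ u+y≉0)))

  sqrtCount≡1+legendre : ∀ a → sqrtCount a ≡ 1ℤ +ℤ χ a
  sqrtCount≡1+legendre a with χ a | legendre-view a
  ... | _ | divisible a≈0 =
    ∑ₚ-unique square-cong (≈-sym a≈0) (λ {u} u²≈a → [ id , id ]′ (*-≈0⇒ u u (≈-trans u²≈a a≈0)))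
  ... | _ | residue a≉0 (y , y²≈a) = begin
    sqrtCount a
      ≡⟨ sqrtCount-cong (≈-sym y²≈a) ⟩
    sqrtCount (toℕ y * toℕ y)
      ≡⟨ ∑ₚ-cong (𝟙-square≈square y≉0) ⟩
    ∑ₚ (λ u → 𝟙[ u ≈ toℕ y ] +ℤ 𝟙[ u + toℕ y ≈ 0 ])
      ≡⟨ ∑ₚ-distrib-+ (λ u → 𝟙[ u ≈ toℕ y ]) (λ u → 𝟙[ u + toℕ y ≈ 0 ]) ⟩
    ∑ₚ (λ u → 𝟙[ u ≈ toℕ y ]) +ℤ ∑ₚ (λ u → 𝟙[ u + toℕ y ≈ 0 ])
      ≡⟨ cong₂ _+ℤ_ (∑ₚ-𝟙 (toℕ y)) (∑ₚ-unique (+-congʳ (toℕ y)) (+-inverseˡ (toℕ y)) root-unique) ⟩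
    1ℤ +ℤ 1ℤ
      ∎
    where
    open ≡-Reasoning
    y≉0 : ¬ toℕ y ≈ 0
    y≉0 y≈0 = a≉0 (≈-trans (≈-sym y²≈a) (*-≈0ʳ (toℕ y) y≈0))
    root-unique : ∀ {u} → u + toℕ y ≈ 0 → u ≈ neg (toℕ y)
    root-unique u+y≈0 = +-cancelʳ (toℕ y) (≈-trans u+y≈0 (≈-sym (+-inverseˡ (toℕ y))))
  ... | _ | nonresidue nonsquare = trans (∑ₚ-cong (λ u → 𝟙-≉ (λ u²≈a →
    nonsquare (u mod p , ≈-trans (square-cong (toℕ-mod u)) u²≈a)))) (sum-replicate-zero p)

  legendre≡sqrtCount-1 : ∀ a → χ a ≡ sqrtCount a -ℤ 1ℤ
  legendre≡sqrtCount-1 a = begin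
    χ a                    ≡⟨ [1+y]-1≡y (χ a) ⟨
    (1ℤ +ℤ χ a) -ℤ 1ℤ      ≡⟨ cong (λ y → y -ℤ 1ℤ) (sqrtCount≡1+legendre a) ⟨
    sqrtCount a -ℤ 1ℤ      ∎
    where
    open ≡-Reasoning
    [1+y]-1≡y : ∀ y → (1ℤ +ℤ y) -ℤ 1ℤ ≡ y
    [1+y]-1≡y = ℤ-Ring.solve-∀

  ∑ₚ-sqrtCount : ∑ₚ sqrtCount ≡ + p
  ∑ₚ-sqrtCount = begin
    ∑ₚ (λ x → ∑ₚ (λ u → 𝟙[ u * u ≈ x ]))   ≡⟨ ∑ₚ-comm (λ x u → 𝟙[ u * u ≈ x ]) ⟩
    ∑ₚ (λ u → ∑ₚ (λ x → 𝟙[ u * u ≈ x ]))   ≡⟨ ∑ₚ-cong (λ u → ∑ₚ-cong (𝟙-sym (u * u))) ⟩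
    ∑ₚ (λ u → ∑ₚ (λ x → 𝟙[ x ≈ u * u ]))   ≡⟨ ∑ₚ-cong (λ u → ∑ₚ-𝟙 (u * u)) ⟩
    ∑ₚ (λ _ → 1ℤ)                          ≡⟨ ∑-const p 1ℤ ⟩
    + p *ℤ 1ℤ                              ≡⟨ ℤP.*-identityʳ (+ p) ⟩
    + p                                    ∎
    where open ≡-Reasoning

  sqrtCount-square+ : ∀ d u → sqrtCount (u * u + d) ≡ ∑ₚ (λ w → 𝟙[ w * w + 2 * w * u ≈ d ])
  sqrtCount-square+ d u = begin
    ∑ₚ (λ v → 𝟙[ v * v ≈ u * u + d ])
      ≡⟨ ∑ₚ-shift (λ v → 𝟙[ v * v ≈ u * u + d ]) (𝟙-congˡ (u * u + d) ∘ square-cong) u ⟨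
    ∑ₚ (λ w → 𝟙[ (w + u) * (w + u) ≈ u * u + d ])
      ≡⟨ ∑ₚ-cong (λ w → cong₂ 𝟙[_≈_] (expand w u) (ℕP.+-comm (u * u) d)) ⟩
    ∑ₚ (λ w → 𝟙[ w * w + 2 * w * u + u * u ≈ d + u * u ])
      ≡⟨ ∑ₚ-cong (λ w → 𝟙-+-cancelʳ (w * w + 2 * w * u) d (u * u)) ⟩
    ∑ₚ (λ w → 𝟙[ w * w + 2 * w * u ≈ d ])
      ∎
    where
    open ≡-Reasoning
    expand : ∀ w u → (w + u) * (w + u) ≡ w * w + 2 * w * u + u * u
    expand = solve-∀

  ∑ₚ-𝟙-square+ : ∀ {d} → ¬ d ≈ 0 → ∀ w → ∑ₚ (λ u → 𝟙[ w * w + 2 * w * u ≈ d ]) ≡ 1ℤ -ℤ 𝟙[ w ≈ 0 ]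
  ∑ₚ-𝟙-square+ {d} d≉0 w with w ≈? 0
  ... | no w≉0 = trans (∑ₚ-𝟙-affine 2w≉0 (w * w) d) (sym (cong (_-ℤ_ 1ℤ) (𝟙-≉ w≉0)))
    where
    2w≉0 : ¬ 2 * w ≈ 0
    2w≉0 = [ 2≉0 , w≉0 ]′ ∘ *-≈0⇒ 2 w
  ... | yes w≈0 = begin
    ∑ₚ (λ u → 𝟙[ w * w + 2 * w * u ≈ d ])
      ≡⟨ ∑ₚ-cong (λ u → 𝟙-≉ (λ lhs≈d → d≉0 (≈-trans (≈-sym lhs≈d) (lhs≈0 u)))) ⟩
    ∑ₚ (λ _ → 0ℤ)
      ≡⟨ sum-replicate-zero p ⟩
    0ℤ
      ≡⟨ cong (_-ℤ_ 1ℤ) (𝟙-≈ w≈0) ⟨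
    1ℤ -ℤ 𝟙[ w ≈ 0 ]
      ∎
    where
    open ≡-Reasoning
    lhs≈0 : ∀ u → w * w + 2 * w * u ≈ 0
    lhs≈0 u = ≈-trans (+-≈0ʳ (w * w) (*-≈0ˡ u (*-≈0ʳ 2 w≈0))) (*-≈0ʳ w w≈0)

  ∑ₚ-1-𝟙 : ∀ b → ∑ₚ (λ x → 1ℤ -ℤ 𝟙[ x ≈ b ]) ≡ + p -ℤ 1ℤ
  ∑ₚ-1-𝟙 b = begin
    ∑ₚ (λ x → 1ℤ -ℤ 𝟙[ x ≈ b ])                ≡⟨ ∑ₚ-distrib-+ (λ _ → 1ℤ) (λ x → -ℤ 𝟙[ x ≈ b ]) ⟩
    ∑ₚ (λ _ → 1ℤ) +ℤ ∑ₚ (λ x → -ℤ 𝟙[ x ≈ b ])  ≡⟨ cong₂ _+ℤ_ (∑-const p 1ℤ) (∑ₚ-neg (λ x → 𝟙[ x ≈ b ])) ⟩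
    + p *ℤ 1ℤ -ℤ ∑ₚ (λ x → 𝟙[ x ≈ b ])         ≡⟨ cong₂ _-ℤ_ (ℤP.*-identityʳ (+ p)) (∑ₚ-𝟙 b) ⟩
    + p -ℤ 1ℤ                                  ∎
    where open ≡-Reasoning

  -- The number of solutions of u² + d = v², read in two ways.
  ∑ₚ-sqrtCount-correlation : ∀ {d} → ¬ d ≈ 0 → ∑ₚ (λ x → sqrtCount x *ℤ sqrtCount (x + d)) ≡ + p -ℤ 1ℤ
  ∑ₚ-sqrtCount-correlation {d} d≉0 = begin
    ∑ₚ (λ x → sqrtCount x *ℤ sqrtCount (x + d))
      ≡⟨ ∑ₚ-cong (λ x → ∑ₚ-*ʳ (λ u → 𝟙[ u * u ≈ x ]) (sqrtCount (x + d))) ⟩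
    ∑ₚ (λ x → ∑ₚ (λ u → 𝟙[ u * u ≈ x ] *ℤ sqrtCount (x + d)))
      ≡⟨ ∑ₚ-comm (λ x u → 𝟙[ u * u ≈ x ] *ℤ sqrtCount (x + d)) ⟩
    ∑ₚ (λ u → ∑ₚ (λ x → 𝟙[ u * u ≈ x ] *ℤ sqrtCount (x + d)))
      ≡⟨ ∑ₚ-cong (λ u → ∑ₚ-cong (λ x → cong (_*ℤ sqrtCount (x + d)) (𝟙-sym (u * u) x))) ⟩
    ∑ₚ (λ u → ∑ₚ (λ x → 𝟙[ x ≈ u * u ] *ℤ sqrtCount (x + d)))
      ≡⟨ ∑ₚ-cong (λ u → ∑ₚ-𝟙-* (λ x → sqrtCount (x + d)) (sqrtCount-cong ∘ +-congʳ d) (u * u)) ⟩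
    ∑ₚ (λ u → sqrtCount (u * u + d))
      ≡⟨ ∑ₚ-cong (sqrtCount-square+ d) ⟩
    ∑ₚ (λ u → ∑ₚ (λ w → 𝟙[ w * w + 2 * w * u ≈ d ]))
      ≡⟨ ∑ₚ-comm (λ u w → 𝟙[ w * w + 2 * w * u ≈ d ]) ⟩
    ∑ₚ (λ w → ∑ₚ (λ u → 𝟙[ w * w + 2 * w * u ≈ d ]))
      ≡⟨ ∑ₚ-cong (∑ₚ-𝟙-square+ d≉0) ⟩
    ∑ₚ (λ w → 1ℤ -ℤ 𝟙[ w ≈ 0 ])
      ≡⟨ ∑ₚ-1-𝟙 0 ⟩
    + p -ℤ 1ℤ
      ∎
    where open ≡-Reasoning

  legendre-correlation : ∀ {d} → ¬ d ≈ 0 → ∑ₚ (λ x → χ x *ℤ χ (x + d)) ≡ -1ℤ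
  legendre-correlation {d} d≉0 = begin
    ∑ₚ (λ x → χ x *ℤ χ (x + d))
      ≡⟨ ∑ₚ-cong (λ x → cong₂ _*ℤ_ (legendre≡sqrtCount-1 x) (legendre≡sqrtCount-1 (x + d))) ⟩
    ∑ₚ (λ x → (C x -ℤ 1ℤ) *ℤ (C (x + d) -ℤ 1ℤ))
      ≡⟨ ∑ₚ-cong (λ x → expand (C x) (C (x + d))) ⟩
    ∑ₚ (λ x → C x *ℤ C (x + d) +ℤ (-ℤ C x +ℤ (-ℤ C (x + d) +ℤ 1ℤ)))
      ≡⟨ ∑ₚ-distrib-+ (λ x → C x *ℤ C (x + d)) (λ x → -ℤ C x +ℤ (-ℤ C (x + d) +ℤ 1ℤ)) ⟩
    ∑ₚ (λ x → C x *ℤ C (x + d)) +ℤ ∑ₚ (λ x → -ℤ C x +ℤ (-ℤ C (x + d) +ℤ 1ℤ))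
      ≡⟨ cong₂ _+ℤ_ (∑ₚ-sqrtCount-correlation d≉0) linear-part ⟩
    (+ p -ℤ 1ℤ) +ℤ (-ℤ + p +ℤ (-ℤ + p +ℤ + p *ℤ 1ℤ))
      ≡⟨ simplify (+ p) ⟩
    -1ℤ ∎
    where
    open ≡-Reasoning
    C : ℕ → ℤ
    C = sqrtCount
    expand : ∀ a b → (a -ℤ 1ℤ) *ℤ (b -ℤ 1ℤ) ≡ a *ℤ b +ℤ (-ℤ a +ℤ (-ℤ b +ℤ 1ℤ))
    expand = ℤ-Ring.solve-∀
    simplify : ∀ n → (n -ℤ 1ℤ) +ℤ (-ℤ n +ℤ (-ℤ n +ℤ n *ℤ 1ℤ)) ≡ -1ℤ
    simplify = ℤ-Ring.solve-∀
    ∑ₚ-sqrtCount-shift : ∑ₚ (λ x → C (x + d)) ≡ + p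
    ∑ₚ-sqrtCount-shift = trans (∑ₚ-shift C sqrtCount-cong d) ∑ₚ-sqrtCount
    linear-part : ∑ₚ (λ x → -ℤ C x +ℤ (-ℤ C (x + d) +ℤ 1ℤ)) ≡ -ℤ + p +ℤ (-ℤ + p +ℤ + p *ℤ 1ℤ)
    linear-part = begin
      ∑ₚ (λ x → -ℤ C x +ℤ (-ℤ C (x + d) +ℤ 1ℤ))
        ≡⟨ ∑ₚ-distrib-+ (λ x → -ℤ C x) (λ x → -ℤ C (x + d) +ℤ 1ℤ) ⟩
      ∑ₚ (λ x → -ℤ C x) +ℤ ∑ₚ (λ x → -ℤ C (x + d) +ℤ 1ℤ)
        ≡⟨ cong (λ v → ∑ₚ (λ x → -ℤ C x) +ℤ v) (∑ₚ-distrib-+ (λ x → -ℤ C (x + d)) (λ _ → 1ℤ)) ⟩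
      ∑ₚ (λ x → -ℤ C x) +ℤ (∑ₚ (λ x → -ℤ C (x + d)) +ℤ ∑ₚ (λ _ → 1ℤ))
        ≡⟨ cong₂ _+ℤ_ (trans (∑ₚ-neg C) (cong -ℤ_ ∑ₚ-sqrtCount))
             (cong₂ _+ℤ_ (trans (∑ₚ-neg (λ x → C (x + d))) (cong -ℤ_ ∑ₚ-sqrtCount-shift)) (∑-const p 1ℤ)) ⟩
      -ℤ + p +ℤ (-ℤ + p +ℤ + p *ℤ 1ℤ) ∎

  legendre-autocorrelation : ∀ d → ∑ₚ (λ x → χ x *ℤ χ (x + d)) ≡ -1ℤ +ℤ + p *ℤ 𝟙[ d ≈ 0 ]
  legendre-autocorrelation d with d ≈? 0
  ... | no d≉0 = begin
    ∑ₚ (λ x → χ x *ℤ χ (x + d))    ≡⟨ legendre-correlation d≉0 ⟩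
    -1ℤ                             ≡⟨ ℤP.+-identityʳ -1ℤ ⟨
    -1ℤ +ℤ 0ℤ                       ≡⟨ cong (-1ℤ +ℤ_) (ℤP.*-zeroʳ (+ p)) ⟨
    -1ℤ +ℤ + p *ℤ 0ℤ                ≡⟨ cong (λ v → -1ℤ +ℤ + p *ℤ v) (𝟙-≉ d≉0) ⟨
    -1ℤ +ℤ + p *ℤ 𝟙[ d ≈ 0 ]        ∎
    where open ≡-Reasoning
  ... | yes d≈0 = begin
    ∑ₚ (λ x → χ x *ℤ χ (x + d))    ≡⟨ ∑ₚ-cong (λ x → cong (χ x *ℤ_) (legendre-cong (+-≈0ʳ x d≈0))) ⟩
    ∑ₚ (λ x → χ x *ℤ χ x)          ≡⟨ ∑ₚ-cong legendre² ⟩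
    ∑ₚ (λ x → 1ℤ -ℤ 𝟙[ x ≈ 0 ])     ≡⟨ ∑ₚ-1-𝟙 0 ⟩
    + p -ℤ 1ℤ                       ≡⟨ ℤP.+-comm (+ p) -1ℤ ⟩
    -1ℤ +ℤ + p                      ≡⟨ cong (-1ℤ +ℤ_) (ℤP.*-identityʳ (+ p)) ⟨
    -1ℤ +ℤ + p *ℤ 1ℤ                ≡⟨ cong (λ v → -1ℤ +ℤ + p *ℤ v) (𝟙-≈ d≈0) ⟨
    -1ℤ +ℤ + p *ℤ 𝟙[ d ≈ 0 ]        ∎
    where open ≡-Reasoning

  legendre-orthogonality : ∀ a b →
    ∑[ γ < p ] (χ (a + (p ∸ toℕ γ)) *ℤ χ (b + (p ∸ toℕ γ))) ≡ -1ℤ +ℤ + p *ℤ 𝟙[ a ≈ b ]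
  legendre-orthogonality a b = begin
    ∑[ γ < p ] (χ (a + (p ∸ toℕ γ)) *ℤ χ (b + (p ∸ toℕ γ)))
      ≡⟨ sum-cong-≗ {p} (λ γ → cong (λ v → χ (a + v) *ℤ χ (b + v)) (neg-toℕ γ)) ⟩
    ∑ₚ (λ x → χ (a + neg x) *ℤ χ (b + neg x))
      ≡⟨ ∑ₚ-cong (λ x → trans (ℤP.*-comm (χ (a + neg x)) (χ (b + neg x)))
                              (cong (χ (b + neg x) *ℤ_) (legendre-cong (a-x≈b-x+a-b x)))) ⟩
    ∑ₚ (λ x → f (b + neg x))
      ≡⟨ ∑ₚ-reflect f f-cong b ⟩
    ∑ₚ f
      ≡⟨ legendre-autocorrelation (a + neg b) ⟩
    -1ℤ +ℤ + p *ℤ 𝟙[ a + neg b ≈ 0 ]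
      ≡⟨ cong (λ v → -1ℤ +ℤ + p *ℤ v) (𝟙-cong x-y≈0⇒x≈y x≈y⇒x-y≈0) ⟩
    -1ℤ +ℤ + p *ℤ 𝟙[ a ≈ b ]
      ∎
    where
    open ≡-Reasoning
    f : ℕ → ℤ
    f y = χ y *ℤ χ (y + (a + neg b))
    f-cong : f Preserves _≈_ ⟶ _≡_
    f-cong y≈z = cong₂ _*ℤ_ (legendre-cong y≈z) (legendre-cong (+-congʳ (a + neg b) y≈z))
    swap : ∀ b n a m → b + n + (a + m) ≡ a + n + (b + m)
    swap = solve-∀
    a-x≈b-x+a-b : ∀ x → a + neg x ≈ b + neg x + (a + neg b)
    a-x≈b-x+a-b x = ≈-sym (≈-trans (≡⇒≈ (swap b (neg x) a (neg b))) (+-≈0ʳ (a + neg x) (+-inverseʳ b)))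

  legendreSum≡∑ : ∀ {m} (α : Fin m → Fin p) γ →
    legendreSum p α γ ≡ ∑[ l < m ] χ (toℕ (α l) + (p ∸ toℕ γ))
  legendreSum≡∑ {m} α γ = trans (cong (foldr _+ℤ_ 0ℤ) (map-tabulate id term)) (foldr-tabulate m term)
    where
    term : Fin m → ℤ
    term l = χ (toℕ (α l) + (p ∸ toℕ γ))

  ∑-legendreSum² : ∀ {m} (α : Fin m → Fin p) → Injective _≡_ _≡_ α →
    ∑[ γ < p ] (legendreSum p α γ *ℤ legendreSum p α γ) ≡ + m *ℤ (+ p -ℤ + m)
  ∑-legendreSum² {m} α α-inj = begin
    ∑[ γ < p ] (S γ *ℤ S γ)
      ≡⟨ sum-cong-≗ {p} square-expand ⟩
    ∑[ γ < p ] ∑[ l < m ] ∑[ k < m ] (t l γ *ℤ t k γ)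
      ≡⟨ ∑-comm (λ γ l → ∑[ k < m ] (t l γ *ℤ t k γ)) ⟩
    ∑[ l < m ] ∑[ γ < p ] ∑[ k < m ] (t l γ *ℤ t k γ)
      ≡⟨ sum-cong-≗ {m} (λ l → ∑-comm (λ γ k → t l γ *ℤ t k γ)) ⟩
    ∑[ l < m ] ∑[ k < m ] ∑[ γ < p ] (t l γ *ℤ t k γ)
      ≡⟨ sum-cong-≗ {m} (λ l → sum-cong-≗ {m} (orthogonal l)) ⟩
    ∑[ l < m ] ∑[ k < m ] (-1ℤ +ℤ + p *ℤ δ l k)
      ≡⟨ sum-cong-≗ {m} row ⟩
    ∑[ l < m ] (+ m *ℤ -1ℤ +ℤ + p)
      ≡⟨ ∑-const m (+ m *ℤ -1ℤ +ℤ + p) ⟩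
    + m *ℤ (+ m *ℤ -1ℤ +ℤ + p)
      ≡⟨ rearrange (+ m) (+ p) ⟩
    + m *ℤ (+ p -ℤ + m)
      ∎
    where
    open ≡-Reasoning
    S : Fin p → ℤ
    S = legendreSum p α
    t : Fin m → Fin p → ℤ
    t l γ = χ (toℕ (α l) + (p ∸ toℕ γ))
    square-expand : ∀ γ → S γ *ℤ S γ ≡ ∑[ l < m ] ∑[ k < m ] (t l γ *ℤ t k γ)
    square-expand γ = begin
      S γ *ℤ S γ
        ≡⟨ cong₂ _*ℤ_ (legendreSum≡∑ α γ) (legendreSum≡∑ α γ) ⟩
      (∑[ l < m ] t l γ) *ℤ (∑[ k < m ] t k γ)
        ≡⟨ *-distribʳ-sum {m} _ (λ l → t l γ) ⟩
      ∑[ l < m ] (t l γ *ℤ ∑[ k < m ] t k γ)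
        ≡⟨ sum-cong-≗ {m} (λ l → *-distribˡ-sum {m} (t l γ) (λ k → t k γ)) ⟩
      ∑[ l < m ] ∑[ k < m ] (t l γ *ℤ t k γ)
        ∎
    orthogonal : ∀ l k → ∑[ γ < p ] (t l γ *ℤ t k γ) ≡ -1ℤ +ℤ + p *ℤ δ l k
    orthogonal l k = trans (legendre-orthogonality (toℕ (α l)) (toℕ (α k)))
      (cong (λ v → -1ℤ +ℤ + p *ℤ v) (trans (𝟙-toℕ (α l) (α k)) (δ-cong α-inj (cong α))))
    row : ∀ l → ∑[ k < m ] (-1ℤ +ℤ + p *ℤ δ l k) ≡ + m *ℤ -1ℤ +ℤ + p
    row l = begin
      ∑[ k < m ] (-1ℤ +ℤ + p *ℤ δ l k)
        ≡⟨ ∑-distrib-+ (λ _ → -1ℤ) (λ k → + p *ℤ δ l k) ⟩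
      ∑[ k < m ] -1ℤ +ℤ ∑[ k < m ] (+ p *ℤ δ l k)
        ≡⟨ cong₂ _+ℤ_ (∑-const m -1ℤ) (sym (*-distribˡ-sum {m} (+ p) (δ l))) ⟩
      + m *ℤ -1ℤ +ℤ + p *ℤ ∑[ k < m ] δ l k
        ≡⟨ cong (λ v → + m *ℤ -1ℤ +ℤ + p *ℤ v) (trans (sum-cong-≗ {m} (δ-sym l)) (∑-δ l)) ⟩
      + m *ℤ -1ℤ +ℤ + p *ℤ 1ℤ
        ≡⟨ cong (_+ℤ_ (+ m *ℤ -1ℤ)) (ℤP.*-identityʳ (+ p)) ⟩
      + m *ℤ -1ℤ +ℤ + p
        ∎
    rearrange : ∀ m p → m *ℤ (m *ℤ -1ℤ +ℤ p) ≡ m *ℤ (p -ℤ m)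
    rearrange = ℤ-Ring.solve-∀

  bigCount-bound : ∀ {m} (α : Fin m → Fin p) → Injective _≡_ _≡_ α →
    bigCount p α * (p * p) ≤ 49 * (m * (p ∸ m))
  bigCount-bound {m} α α-inj = ℕP.≤-trans
    (length-filter-*≤sum (λ γ → p ℕ.≤? 7 * ∣ S γ ∣) g big⇒p²≤g (allFin p))
    (ℕP.≤-reflexive (ℤP.+-injective (begin
      + ListNat.sum (map g (allFin p))
        ≡⟨ cong (+_ ∘ ListNat.sum) (map-tabulate id g) ⟩
      + ListNat.sum (tabulate g)
        ≡⟨ +sum-tabulate p g ⟩
      ∑[ γ < p ] (+ g γ)
        ≡⟨ sum-cong-≗ {p} (λ γ → trans (ℤP.pos-* 49 (∣ S γ ∣ * ∣ S γ ∣))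
                                      (cong (+ 49 *ℤ_) (+∣i∣*∣i∣≡i*i (S γ)))) ⟩
      ∑[ γ < p ] (+ 49 *ℤ (S γ *ℤ S γ))
        ≡⟨ *-distribˡ-sum {p} (+ 49) (λ γ → S γ *ℤ S γ) ⟨
      + 49 *ℤ ∑[ γ < p ] (S γ *ℤ S γ)
        ≡⟨ cong (+ 49 *ℤ_) (∑-legendreSum² α α-inj) ⟩
      + 49 *ℤ (+ m *ℤ (+ p -ℤ + m))
        ≡⟨ cong (λ v → + 49 *ℤ (+ m *ℤ v)) (trans (ℤP.m-n≡m⊖n p m) (ℤP.⊖-≥ (FP.injective⇒≤ α-inj))) ⟩
      + 49 *ℤ (+ m *ℤ + (p ∸ m))
        ≡⟨ trans (ℤP.pos-* 49 (m * (p ∸ m))) (cong (+ 49 *ℤ_) (ℤP.pos-* m (p ∸ m))) ⟨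
      + (49 * (m * (p ∸ m)))
        ∎)))
    where
    open ≡-Reasoning
    S : Fin p → ℤ
    S = legendreSum p α
    g : Fin p → ℕ
    g γ = 49 * (∣ S γ ∣ * ∣ S γ ∣)
    square : ∀ s → 7 * s * (7 * s) ≡ 49 * (s * s)
    square = solve-∀
    big⇒p²≤g : ∀ γ → p ≤ 7 * ∣ S γ ∣ → p * p ≤ g γ
    big⇒p²≤g γ p≤7S = ℕP.≤-trans (ℕP.*-mono-≤ p≤7S p≤7S) (ℕP.≤-reflexive (square ∣ S γ ∣))

prime>2⇒odd : ∀ {p} → Prime p → 2 < p → ¬ 2 ∣ p
prime>2⇒odd p-prime 2<p 2∣p with prime⇒irreducible p-prime 2∣p
... | inj₁ ()
... | inj₂ refl = ℕP.<-irrefl refl 2<p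

odd⇒≡half+suc-half : ∀ n → ¬ 2 ∣ n → n ≡ (n ∸ 1) / 2 + suc ((n ∸ 1) / 2)
odd⇒≡half+suc-half n n-odd with n % 2 | m≡m%n+[m/n]*n n 2 | m%n<n n 2
... | 0 | n≡q*2 | _ = contradiction (divides (n / 2) n≡q*2) n-odd
... | 1 | n≡1+q*2 | _ = begin
  n                              ≡⟨ n≡1+q*2 ⟩
  1 + n / 2 * 2                  ≡⟨ double+1 (n / 2) ⟩
  n / 2 + suc (n / 2)            ≡⟨ cong (λ h → h + suc h) half≡q ⟨
  (n ∸ 1) / 2 + suc ((n ∸ 1) / 2) ∎
  where
  open ≡-Reasoning
  double+1 : ∀ q → 1 + q * 2 ≡ q + suc q
  double+1 = solve-∀
  half≡q : (n ∸ 1) / 2 ≡ n / 2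
  half≡q = trans (cong (λ v → (v ∸ 1) / 2) n≡1+q*2) (m*n/n≡m (n / 2) 2)
... | suc (suc _) | _ | s≤s (s≤s ())

n[2m+1]²≤49m[m+1]⇒n≤12 : ∀ n m → n * ((m + suc m) * (m + suc m)) ≤ 49 * (m * suc m) → n ≤ 12
n[2m+1]²≤49m[m+1]⇒n≤12 n m bound with n ℕ.≤? 12
... | yes n≤12 = n≤12
... | no n≰12 = contradiction
  (ℕP.≤-trans (ℕP.*-monoˡ-≤ ((m + suc m) * (m + suc m)) (ℕP.≰⇒> n≰12)) bound)
  (ℕP.<⇒≱ (ℕP.≤-trans (s≤s (ℕP.m≤m+n _ _)) (ℕP.≤-reflexive (sym (expand m)))))
  where
  expand : ∀ m → 13 * ((m + suc m) * (m + suc m)) ≡ suc (49 * (m * suc m) + (3 * (m * suc m) + 12))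
  expand = solve-∀

proposition4p6 : (p : ℕ) .{{_ : NonZero p}} → Prime p → 7408848 < p →
    (α : Fin ((p ∸ 1) / 2) → Fin p) → Injective _≡_ _≡_ α →
    bigCount p α ≤ 16
proposition4p6 p p-prime p>7408848 α α-inj =
  ℕP.≤-trans (n[2m+1]²≤49m[m+1]⇒n≤12 (bigCount p α) m second-moment-bound) (ℕP.m≤m+n 12 4)
  where
  open ℕP.≤-Reasoning
  p-odd : ¬ 2 ∣ p
  p-odd = prime>2⇒odd p-prime (ℕP.<-trans (s≤s (s≤s (s≤s z≤n))) p>7408848)
  m : ℕ
  m = (p ∸ 1) / 2
  p≡2m+1 : p ≡ m + suc m
  p≡2m+1 = odd⇒≡half+suc-half p p-odd
  second-moment-bound : bigCount p α * ((m + suc m) * (m + suc m)) ≤ 49 * (m * suc m)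
  second-moment-bound = begin
    bigCount p α * ((m + suc m) * (m + suc m))  ≡⟨ cong (λ q → bigCount p α * (q * q)) p≡2m+1 ⟨
    bigCount p α * (p * p)                      ≤⟨ Legendre.bigCount-bound p p-prime p-odd α α-inj ⟩
    49 * (m * (p ∸ m))                          ≡⟨ cong (λ q → 49 * (m * (q ∸ m))) p≡2m+1 ⟩
    49 * (m * (m + suc m ∸ m))                  ≡⟨ cong (λ q → 49 * (m * q)) (ℕP.m+n∸m≡n m (suc m)) ⟩
    49 * (m * suc m)                            ∎
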